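{- Let $\pi\in I(321)$ be an involution without fixed points, $\pi=(m_1,M_1)(m_2,M_2)\cdots(m_m,M_m)$ with $m_i<M_i$, $m_1<\cdots<m_m$ and $M_1<\cdots<M_m$. For $1\le i<m$: if the minima $m_i,m_{i+1}$ are down-connected, then $M_{i+1}=M_i+1$; conversely, if $M_{i+1}=M_i+1$, then the minima $m_i,m_{i+1}$ are down-connected. Likewise, the maxima $M_i,M_{i+1}$ are up-connected if and only if $m_{i+1}=m_i+1$.
   Context: A permutation of length $n$ is a bijection of $\{1,\dots,n\}$ in one-line notation. A permutation avoids $321$ if it has no indices $i<j<k$ with $\pi(i)>\pi(j)>\pi(k)$. An involution satisfies $\pi(\pi(i))=i$ for all $i$; $I(321)$ is the set of involutions avoiding $321$. For an involution $\pi$ of length $n$ without fixed points, the plot of $\pi$ is the polygonal line joining the points $(1,\pi(1)),(2,\pi(2)),\dots,(n,\pi(n))$ in this order. The maxima are the values $M_i$ (points $(m_i,M_i)$, above the line $y=x$) and the minima are the values $m_i$ (points $(M_i,m_i)$, below $y=x$). Two maxima (resp. two minima) are up-connected (resp. down-connected) if they are joined by a single segment of the plot, i.e. they occur at consecutive positions of $\pi$; such a segment then neither crosses $y=x$ nor contains another maximum (resp. minimum). -}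

module Defs where

open import Data.Nat using (ℕ; suc)
open import Data.Fin using (Fin; toℕ; _<_)
open import Data.Product using (Σ; _×_; ∃-syntax)
open import Data.Sum using (_⊎_)
open import Relation.Binary.PropositionalEquality using (_≡_; _≢_)
open import Relation.Nullary using (¬_)

-- A permutation of length n, in one-line notation, is a map Fin n → Fin n
-- (positions and values are 0-indexed; shifting by one changes nothing below).
-- An involution π (π ∘ π = id) is automatically a bijection.
Involution : ∀ {n} → (Fin n → Fin n) → Set
Involution π = ∀ i → π (π i) ≡ i

FixedPointFree : ∀ {n} → (Fin n → Fin n) → Set
FixedPointFree π = ∀ i → π i ≢ i

Avoids321 : ∀ {n} → (Fin n → Fin n) → Set
Avoids321 {n} π = ¬ (Σ (Fin n) λ i → Σ (Fin n) λ j → Σ (Fin n) λ k →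
  i < j × j < k × π j < π i × π k < π j)

Adjacent : ∀ {n} → Fin n → Fin n → Set
Adjacent p q = toℕ q ≡ suc (toℕ p) ⊎ toℕ p ≡ suc (toℕ q)

-- the values a and b are maxima (points (p, π p) above y = x)
-- occurring at consecutive positions of π
UpConnected : ∀ {n} → (Fin n → Fin n) → Fin n → Fin n → Set
UpConnected {n} π a b = ∃[ p ] ∃[ q ]
  (π p ≡ a × π q ≡ b × p < π p × q < π q × Adjacent p q)

-- the values a and b are minima (points (p, π p) below y = x)
-- occurring at consecutive positions of π
DownConnected : ∀ {n} → (Fin n → Fin n) → Fin n → Fin n → Set
DownConnected {n} π a b = ∃[ p ] ∃[ q ]
  (π p ≡ a × π q ≡ b × π p < p × π q < q × Adjacent p q)

module Submission where

-- In an involution π the value a occurs at exactly one position,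
-- namely π a.  So two values a = π p and b = π q occur at consecutive
-- positions exactly when the positions p and q are consecutive integers,
-- and when p < q this means q = p + 1.  For the cycle (mᵢ, Mᵢ) the minimum
-- mᵢ sits at position Mᵢ and the maximum Mᵢ sits at position mᵢ.  Hence
--   mᵢ, mᵢ₊₁ down-connected  ⇔  Mᵢ₊₁ = Mᵢ + 1,
--   Mᵢ, Mᵢ₊₁ up-connected    ⇔  mᵢ₊₁ = mᵢ + 1,
-- because both lists are increasing.

open import Defs
open import Data.Nat using (ℕ; suc)
open import Data.Fin using (Fin; toℕ; _<_)
open import Data.Product using (_×_; ∃-syntax; _,_)
open import Data.Sum using (_⊎_; inj₁; inj₂)
open import Function.Bundles using (_⇔_; mk⇔)
open import Relation.Binary.PropositionalEquality using (_≡_; refl; sym; trans; cong; subst)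
open import Data.Nat.Properties using (≤-reflexive; <-irrefl; <-trans; n<1+n)
open import Data.Empty using (⊥-elim)

involution-injective : ∀ {n} {π : Fin n → Fin n} → Involution π →
  ∀ p q → π p ≡ π q → p ≡ q
involution-injective {π = π} inv p q e =
  trans (sym (inv p)) (trans (cong π e) (inv q))

adjacent-ordered : ∀ {n} {p q : Fin n} → p < q → Adjacent p q →
  toℕ q ≡ suc (toℕ p)
adjacent-ordered p<q (inj₁ q≡1+p) = q≡1+p
adjacent-ordered p<q (inj₂ p≡1+q) =
  ⊥-elim (<-irrefl p≡1+q (<-trans p<q (n<1+n _)))

-- The values a and b occur at consecutive positions, both on the side of
-- the diagonal described by R.  With R x = π x < x this is DownConnected,
-- with R x = x < π x it is UpConnected.
OccurAdjacent : ∀ {n} → (Fin n → Fin n) → (Fin n → Set) → Fin n → Fin n → Set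
OccurAdjacent π R a b = ∃[ p ] ∃[ q ] (π p ≡ a × π q ≡ b × R p × R q × Adjacent p q)

-- If a and b occur at positions p < q on the R-side, they occur adjacently
-- exactly when q = p + 1: the positions are forced by injectivity.
occurAdjacent⇔ : ∀ {n} {π : Fin n → Fin n} (R : Fin n → Set) → Involution π →
  ∀ {p q a b} → π p ≡ a → π q ≡ b → R p → R q → p < q →
  OccurAdjacent π R a b ⇔ (toℕ q ≡ suc (toℕ p))
occurAdjacent⇔ {π = π} R inv {p} {q} {a} {b} πp≡a πq≡b Rp Rq p<q = mk⇔ forced witness
  where
  forced : OccurAdjacent π R a b → toℕ q ≡ suc (toℕ p)
  forced (p′ , q′ , πp′≡a , πq′≡b , _ , _ , adj)
    with involution-injective inv p′ p (trans πp′≡a (sym πp≡a))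
       | involution-injective inv q′ q (trans πq′≡b (sym πq≡b))
  ... | refl | refl = adjacent-ordered p<q adj

  witness : toℕ q ≡ suc (toℕ p) → OccurAdjacent π R a b
  witness q≡1+p = p , q , πp≡a , πq≡b , Rp , Rq , inj₁ q≡1+p

proposition6p1 : (n : ℕ) (π : Fin n → Fin n) →
    Involution π → FixedPointFree π → Avoids321 π →
    (m : ℕ) (mins maxs : Fin m → Fin n) →
    (∀ i → π (mins i) ≡ maxs i) →
    (∀ i → mins i < maxs i) →
    (∀ x → (∃[ i ] mins i ≡ x) ⊎ (∃[ i ] maxs i ≡ x)) →
    (∀ i j → i < j → mins i < mins j) →
    (∀ i j → i < j → maxs i < maxs j) →
    (i j : Fin m) → toℕ j ≡ suc (toℕ i) →
    (DownConnected π (mins i) (mins j) ⇔ (toℕ (maxs j) ≡ suc (toℕ (maxs i))))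
    × (UpConnected π (maxs i) (maxs j) ⇔ (toℕ (mins j) ≡ suc (toℕ (mins i))))
proposition6p1 n π inv _ _ m mins maxs πmin≡max min<max _ incMin incMax i j j≡1+i =
    occurAdjacent⇔ (λ x → π x < x) inv (πmax≡min i) (πmax≡min j)
      (belowDiagonal i) (belowDiagonal j) (incMax i j i<j)
  , occurAdjacent⇔ (λ x → x < π x) inv (πmin≡max i) (πmin≡max j)
      (aboveDiagonal i) (aboveDiagonal j) (incMin i j i<j)
  where
  i<j : i < j
  i<j = ≤-reflexive (sym j≡1+i)

  πmax≡min : ∀ k → π (maxs k) ≡ mins k
  πmax≡min k = trans (cong π (sym (πmin≡max k))) (inv (mins k))

  belowDiagonal : ∀ k → π (maxs k) < maxs k
  belowDiagonal k = subst (_< maxs k) (sym (πmax≡min k)) (min<max k)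

  aboveDiagonal : ∀ k → mins k < π (mins k)
  aboveDiagonal k = subst (mins k <_) (sym (πmin≡max k)) (min<max k)
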